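{- The infinite binary words $010110\,\mathbf{t}$ and $101001101001\,\mathbf{t}$ are overlap-free.
   Context: Let $\mu$ be the morphism on $\{0,1\}^*$ with $\mu(0)=01$, $\mu(1)=10$, and let $\mathbf{t}=\mu^\omega(0)=0110100110010110\cdots$ be the Thue–Morse word (the fixed point of $\mu$ starting with $0$). For a finite word $u$, $u\mathbf{t}$ denotes the infinite word obtained by prefixing $u$ to $\mathbf{t}$. An overlap is a word of the form $xYxYx$ with $x$ a letter and $Y$ a possibly empty word; an (infinite) word is overlap-free if none of its finite factors (contiguous subwords) is an overlap. -}

module Defs where

open import Data.Nat using (ℕ; zero; suc)
open import Data.Bool using (Bool; true; false)
open import Data.List using (List; []; _∷_; _++_; concatMap; lookup; length)
open import Data.Product using (∃-syntax; _×_)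
open import Relation.Binary.PropositionalEquality using (_≡_)
open import Relation.Nullary using (¬_)

-- Binary letters: false = 0, true = 1.
-- Infinite words over {0,1}: functions ℕ → Bool.
InfWord : Set
InfWord = ℕ → Bool

μ₁ : Bool → List Bool
μ₁ false = false ∷ true ∷ []
μ₁ true  = true ∷ false ∷ []

μ : List Bool → List Bool
μ = concatMap μ₁

μ^ : ℕ → List Bool
μ^ zero    = false ∷ []
μ^ (suc k) = μ (μ^ k)

-- the n-th letter of the length-≥(n+1) word v, defaulting to 0 past the end
at : List Bool → ℕ → Bool
at []       _       = false
at (a ∷ v)  zero    = a
at (a ∷ v)  (suc n) = at v n

-- t = μ^ω(0): since μ^k(0) is a prefix of μ^(k+1)(0) and |μ^(n+1)(0)| = 2^(n+1) > n,
-- the n-th letter of t is the n-th letter of μ^(n+1)(0).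
thueMorse : InfWord
thueMorse n = at (μ^ (suc n)) n

_·_ : List Bool → InfWord → InfWord
([]     · w) n       = w n
((a ∷ u) · w) zero    = a
((a ∷ u) · w) (suc n) = (u · w) n

factor : InfWord → ℕ → ℕ → List Bool
factor w i zero    = []
factor w i (suc ℓ) = w i ∷ factor w (suc i) ℓ

IsOverlap : List Bool → Set
IsOverlap z = ∃[ x ] ∃[ Y ] (z ≡ x ∷ Y ++ x ∷ Y ++ x ∷ [])

OverlapFree : InfWord → Set
OverlapFree w = ∀ i ℓ → ¬ IsOverlap (factor w i ℓ)

u₁ : List Bool
u₁ = false ∷ true ∷ false ∷ true ∷ true ∷ false ∷ []

u₂ : List Bool
u₂ = true ∷ false ∷ true ∷ false ∷ false ∷ true ∷ true ∷ false ∷ true ∷ false ∷ false ∷ true ∷ []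

-- Work with periods: an overlap of length 2P+1 starting at position i is a
-- stretch w(i..i+P) that recurs P letters later.  If w = μ(b), an overlap of even period 2Q
-- in w halves to an overlap of period Q in b, while an odd period P ≥ 3 forces a cube aaa in b
-- and period 1 is impossible, since μ-images have no factor aaa.  In every case b has an
-- overlap of strictly smaller period, so by induction on the period a family of words each of
-- which is a tail of the μ-image of a member is overlap-free; 0t and 1t form such a family
-- (xt is the tail of μ((¬x)t)).  Then 001t is the tail of μ²(1t) and u₁t = μ(001t), while
-- u₂t = μ(110110t), where 110110t has the tail 10110t of u₁t and a short parity argument rules
-- out an overlap at its first position.
module Submission where

open import Defs
open import Data.Bool using (Bool; true; false; not)
open import Data.Bool.Properties using (not-injective; not-involutive; not-¬)
open import Data.Empty using (⊥-elim)
open import Data.List using (List; []; _∷_; _++_; length)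
open import Data.List.Properties using (length-++; ++-assoc; ++-identityʳ)
open import Data.Nat using (ℕ; zero; suc; _+_; _≤_; _<_; z≤n; s≤s)
open import Data.Nat.Induction using (<-rec)
open import Data.Nat.Properties
  using (≤-trans; ≤-<-trans; n≤1+n; m≤n+m; +-monoʳ-<; +-comm; +-assoc; +-suc; +-identityʳ)
open import Data.Product using (∃-syntax; _×_; _,_; proj₁; proj₂)
open import Relation.Binary.PropositionalEquality
  using (_≡_; _≗_; refl; sym; trans; cong; subst; module ≡-Reasoning)
open import Relation.Nullary using (¬_)

open ≡-Reasoning

dbl : ℕ → ℕ
dbl zero    = zero
dbl (suc n) = suc (suc (dbl n))

dbl-+ : ∀ m n → dbl (m + n) ≡ dbl m + dbl n
dbl-+ zero    n = refl
dbl-+ (suc m) n = cong (λ k → suc (suc k)) (dbl-+ m n)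

dbl-+-odd : ∀ m n → dbl m + suc (dbl n) ≡ suc (dbl (m + n))
dbl-+-odd m n = trans (+-suc (dbl m) (dbl n)) (cong suc (sym (dbl-+ m n)))

dbl-mono-≤ : ∀ {m n} → m ≤ n → dbl m ≤ dbl n
dbl-mono-≤ z≤n       = z≤n
dbl-mono-≤ (s≤s m≤n) = s≤s (s≤s (dbl-mono-≤ m≤n))

n≤dbl : ∀ n → n ≤ dbl n
n≤dbl zero    = z≤n
n≤dbl (suc n) = s≤s (≤-trans (n≤dbl n) (n≤1+n _))

data Parity : ℕ → Set where
  even : ∀ k → Parity (dbl k)
  odd  : ∀ k → Parity (suc (dbl k))

parity : ∀ n → Parity n
parity zero = even 0
parity (suc n) with parity n
... | even k = odd k
... | odd k  = even (suc k)

at-++ˡ : ∀ v r {n} → n < length v → at (v ++ r) n ≡ at v n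
at-++ˡ (a ∷ v) r {zero}  _         = refl
at-++ˡ (a ∷ v) r {suc n} (s≤s n<v) = at-++ˡ v r n<v

at-++ʳ : ∀ v r n → at (v ++ r) (length v + n) ≡ at r n
at-++ʳ []      r n = refl
at-++ʳ (a ∷ v) r n = at-++ʳ v r n

at-++-∷ : ∀ v x r {n} → n ≤ length v → at (v ++ x ∷ r) n ≡ at (v ++ x ∷ []) n
at-++-∷ []      x r z≤n       = refl
at-++-∷ (a ∷ v) x r {zero}  _ = refl
at-++-∷ (a ∷ v) x r {suc n} (s≤s n≤v) = at-++-∷ v x r n≤v

μ-++ : ∀ u v → μ (u ++ v) ≡ μ u ++ μ v
μ-++ []      v = refl
μ-++ (a ∷ u) v = begin
  μ₁ a ++ μ (u ++ v)     ≡⟨ cong (μ₁ a ++_) (μ-++ u v) ⟩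
  μ₁ a ++ (μ u ++ μ v)   ≡⟨ sym (++-assoc (μ₁ a) (μ u) (μ v)) ⟩
  (μ₁ a ++ μ u) ++ μ v   ∎

length-μ : ∀ v → length (μ v) ≡ dbl (length v)
length-μ []          = refl
length-μ (false ∷ v) = cong (λ k → suc (suc k)) (length-μ v)
length-μ (true ∷ v)  = cong (λ k → suc (suc k)) (length-μ v)

at-μ-even : ∀ v {n} → n < length v → at (μ v) (dbl n) ≡ at v n
at-μ-even (false ∷ v) {zero}  _         = refl
at-μ-even (true ∷ v)  {zero}  _         = refl
at-μ-even (false ∷ v) {suc n} (s≤s n<v) = at-μ-even v n<v
at-μ-even (true ∷ v)  {suc n} (s≤s n<v) = at-μ-even v n<v

at-μ-odd : ∀ v {n} → n < length v → at (μ v) (suc (dbl n)) ≡ not (at v n)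
at-μ-odd (false ∷ v) {zero}  _         = refl
at-μ-odd (true ∷ v)  {zero}  _         = refl
at-μ-odd (false ∷ v) {suc n} (s≤s n<v) = at-μ-odd v n<v
at-μ-odd (true ∷ v)  {suc n} (s≤s n<v) = at-μ-odd v n<v

μ^-prefix-suc : ∀ k → ∃[ r ] (μ^ (suc k) ≡ μ^ k ++ r)
μ^-prefix-suc zero = true ∷ [] , refl
μ^-prefix-suc (suc k) with μ^-prefix-suc k
... | r , e = μ r , trans (cong μ e) (μ-++ (μ^ k) r)

μ^-prefix : ∀ d k → ∃[ r ] (μ^ (d + k) ≡ μ^ k ++ r)
μ^-prefix zero    k = [] , sym (++-identityʳ (μ^ k))
μ^-prefix (suc d) k with μ^-prefix d k | μ^-prefix-suc (d + k)
... | r , e | r′ , e′ = r ++ r′ , (begin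
  μ^ (suc (d + k))      ≡⟨ e′ ⟩
  μ^ (d + k) ++ r′      ≡⟨ cong (_++ r′) e ⟩
  (μ^ k ++ r) ++ r′     ≡⟨ ++-assoc (μ^ k) r r′ ⟩
  μ^ k ++ (r ++ r′)     ∎)

at-μ^-stable : ∀ d k {n} → n < length (μ^ k) → at (μ^ (d + k)) n ≡ at (μ^ k) n
at-μ^-stable d k {n} n<μ^k with μ^-prefix d k
... | r , e = trans (cong (λ v → at v n) e) (at-++ˡ (μ^ k) r n<μ^k)

n<length-μ^ : ∀ n → n < length (μ^ n)
n<length-μ^ zero    = s≤s z≤n
n<length-μ^ (suc n) = subst (suc n <_) (sym (length-μ (μ^ n)))
  (≤-trans (s≤s (s≤s (n≤dbl n))) (dbl-mono-≤ (n<length-μ^ n)))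

thueMorse-at-μ^ : ∀ k {n} → n < length (μ^ k) → thueMorse n ≡ at (μ^ k) n
thueMorse-at-μ^ k {n} n<μ^k = begin
  at (μ^ (suc n)) n         ≡⟨ sym (at-μ^-stable k (suc n) n<μ^sucn) ⟩
  at (μ^ (k + suc n)) n     ≡⟨ cong (λ d → at (μ^ d) n) (+-comm k (suc n)) ⟩
  at (μ^ (suc n + k)) n     ≡⟨ at-μ^-stable (suc n) k n<μ^k ⟩
  at (μ^ k) n               ∎
  where
  n<μ^sucn : n < length (μ^ (suc n))
  n<μ^sucn = ≤-trans (n≤1+n _) (n<length-μ^ (suc n))

record IsμImage (w b : InfWord) : Set where
  constructor μ-image
  field letters : ∀ n → w (dbl n) ≡ b n × w (suc (dbl n)) ≡ not (b n)
open IsμImage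

thueMorse-isμImage : IsμImage thueMorse thueMorse
thueMorse-isμImage = μ-image λ n → even-letter n , odd-letter n
  where
  module _ (n : ℕ) where
    v : List Bool
    v = μ^ (suc n)
    n<v : n < length v
    n<v = ≤-trans (n≤1+n _) (n<length-μ^ (suc n))
    2+2n≤∣μv∣ : dbl (suc n) ≤ length (μ v)
    2+2n≤∣μv∣ = subst (dbl (suc n) ≤_) (sym (length-μ v)) (dbl-mono-≤ n<v)
    even-letter : thueMorse (dbl n) ≡ thueMorse n
    even-letter = trans (thueMorse-at-μ^ (suc (suc n)) (≤-trans (n≤1+n _) 2+2n≤∣μv∣)) (at-μ-even v n<v)
    odd-letter : thueMorse (suc (dbl n)) ≡ not (thueMorse n)
    odd-letter = trans (thueMorse-at-μ^ (suc (suc n)) 2+2n≤∣μv∣) (at-μ-odd v n<v)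

μ-prepend : ∀ {w b} u → IsμImage w b → IsμImage (μ u · w) (u · b)
μ-prepend []          m = m
μ-prepend (false ∷ u) m = μ-image λ { zero → refl , refl ; (suc n) → letters (μ-prepend u m) n }
μ-prepend (true ∷ u)  m = μ-image λ { zero → refl , refl ; (suc n) → letters (μ-prepend u m) n }

shift : ℕ → InfWord → InfWord
shift i w n = w (i + n)

shift-shift : ∀ m n w → shift m (shift n w) ≗ shift (n + m) w
shift-shift m n w k = cong w (sym (+-assoc n m k))

shift-isμImage : ∀ {w b} k → IsμImage w b → IsμImage (shift (dbl k) w) (shift k b)
shift-isμImage {w} {b} k m = μ-image λ n →
    trans (cong w (sym (dbl-+ k n))) (proj₁ (letters m (k + n)))
  , trans (cong w (dbl-+-odd k n)) (proj₂ (letters m (k + n)))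

-- w begins with an overlap of period P (of length 2P + 1).
OverlapPrefix : InfWord → ℕ → Set
OverlapPrefix w P = ∀ j → j ≤ P → w j ≡ w (j + P)

OverlapFree′ : InfWord → Set
OverlapFree′ w = ∀ i p → ¬ OverlapPrefix (shift i w) (suc p)

overlapPrefix-resp-≗ : ∀ {w v P} → w ≗ v → OverlapPrefix w P → OverlapPrefix v P
overlapPrefix-resp-≗ {P = P} w≗v H j j≤P = trans (sym (w≗v j)) (trans (H j j≤P) (w≗v (j + P)))

overlapFree′-tail : ∀ {w} → OverlapFree′ w → OverlapFree′ (shift 1 w)
overlapFree′-tail ofw i = ofw (suc i)

overlapFree′-∷ : ∀ {w} → (∀ p → ¬ OverlapPrefix w (suc p)) → OverlapFree′ (shift 1 w) → OverlapFree′ w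
overlapFree′-∷ noPrefix oftail zero    = noPrefix
overlapFree′-∷ noPrefix oftail (suc i) = oftail i

at-factor : ∀ w i {ℓ j} → j < ℓ → at (factor w i ℓ) j ≡ w (i + j)
at-factor w i {suc ℓ} {zero}  _         = cong w (sym (+-identityʳ i))
at-factor w i {suc ℓ} {suc j} (s≤s j<ℓ) = trans (at-factor w (suc i) j<ℓ) (cong w (sym (+-suc i j)))

length-factor : ∀ w i ℓ → length (factor w i ℓ) ≡ ℓ
length-factor w i zero    = refl
length-factor w i (suc ℓ) = cong suc (length-factor w (suc i) ℓ)

-- With A = xY the overlap is A ++ (A ++ x), so both of its halves begin with A ++ x.
overlap-period : ∀ x Y {j} → j ≤ length (x ∷ Y) →
  at (x ∷ Y ++ x ∷ Y ++ x ∷ []) j ≡ at (x ∷ Y ++ x ∷ Y ++ x ∷ []) (length (x ∷ Y) + j)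
overlap-period x Y {j} j≤A = trans (at-++-∷ (x ∷ Y) x (Y ++ x ∷ []) j≤A)
  (sym (at-++ʳ (x ∷ Y) (x ∷ Y ++ x ∷ []) j))

factor-overlapPrefix : ∀ w i ℓ → IsOverlap (factor w i ℓ) → ∃[ p ] OverlapPrefix (shift i w) (suc p)
factor-overlapPrefix w i ℓ (x , Y , e) = length Y , λ j j≤A → begin
    w (i + j)                  ≡⟨ sym (at-factor w i (j<ℓ j≤A)) ⟩
    at (factor w i ℓ) j        ≡⟨ cong (λ v → at v j) e ⟩
    at Z j                     ≡⟨ overlap-period x Y j≤A ⟩
    at Z (A + j)               ≡⟨ cong (λ v → at v (A + j)) (sym e) ⟩
    at (factor w i ℓ) (A + j)  ≡⟨ at-factor w i (A+j<ℓ j≤A) ⟩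
    w (i + (A + j))            ≡⟨ cong (λ k → w (i + k)) (+-comm A j) ⟩
    w (i + (j + A))            ∎
  where
  A = length (x ∷ Y)
  Z = x ∷ Y ++ x ∷ Y ++ x ∷ []
  ℓ≡ : ℓ ≡ A + (A + 1)
  ℓ≡ = begin
    ℓ                                ≡⟨ sym (length-factor w i ℓ) ⟩
    length (factor w i ℓ)            ≡⟨ cong length e ⟩
    length ((x ∷ Y) ++ x ∷ Y ++ x ∷ []) ≡⟨ length-++ (x ∷ Y) ⟩
    A + length ((x ∷ Y) ++ x ∷ [])   ≡⟨ cong (A +_) (length-++ (x ∷ Y)) ⟩
    A + (A + 1)                      ∎
  A+j<ℓ : ∀ {j} → j ≤ A → A + j < ℓ
  A+j<ℓ {j} j≤A = subst (A + j <_) (sym ℓ≡) (+-monoʳ-< A (subst (j <_) (+-comm 1 A) (s≤s j≤A)))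
  j<ℓ : ∀ {j} → j ≤ A → j < ℓ
  j<ℓ {j} j≤A = ≤-<-trans (m≤n+m j A) (A+j<ℓ j≤A)

overlapFree′⇒overlapFree : ∀ {w} → OverlapFree′ w → OverlapFree w
overlapFree′⇒overlapFree {w} ofw i ℓ ov with factor-overlapPrefix w i ℓ ov
... | p , H = ofw i p H

cube : ∀ {v} k → v k ≡ v (suc k) → v (suc k) ≡ v (suc (suc k)) → OverlapPrefix (shift k v) 1
cube {v} k e₀ e₁ zero    _ = trans (cong v (+-identityʳ k)) (trans e₀ (cong v (+-comm 1 k)))
cube {v} k e₀ e₁ (suc zero) _ = trans (cong v (+-comm k 1)) (trans e₁ (cong v (+-comm 2 k)))
cube {v} k e₀ e₁ (suc (suc j)) (s≤s ())

ShorterOverlap : InfWord → ℕ → Set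
ShorterOverlap b p = ∃[ k ] ∃[ p′ ] (p′ < p × OverlapPrefix (shift k b) (suc p′))

shorterOverlap-shift : ∀ {b p} k → ShorterOverlap (shift k b) p → ShorterOverlap b p
shorterOverlap-shift {b} k (k′ , p′ , p′<p , H) = k + k′ , p′ , p′<p , overlapPrefix-resp-≗ (shift-shift k′ k b) H

module _ {w b : InfWord} (m : IsμImage w b) where

  μ-even-letter : ∀ n → w (dbl n) ≡ b n
  μ-even-letter n = proj₁ (letters m n)

  μ-odd-letter : ∀ n → w (suc (dbl n)) ≡ not (b n)
  μ-odd-letter n = proj₂ (letters m n)

  μ-adjacent-distinct : ∀ n → ¬ w (dbl n) ≡ w (suc (dbl n))
  μ-adjacent-distinct n e = not-¬ refl (trans (sym (μ-even-letter n)) (trans e (μ-odd-letter n)))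

  μ-halve-even : ∀ {n Q} → w (dbl n) ≡ w (dbl n + dbl Q) → b n ≡ b (n + Q)
  μ-halve-even {n} {Q} e = begin
    b n                   ≡⟨ sym (μ-even-letter n) ⟩
    w (dbl n)             ≡⟨ e ⟩
    w (dbl n + dbl Q)     ≡⟨ cong w (sym (dbl-+ n Q)) ⟩
    w (dbl (n + Q))       ≡⟨ μ-even-letter (n + Q) ⟩
    b (n + Q)             ∎

  μ-halve-odd : ∀ {n Q} → w (suc (dbl n)) ≡ w (suc (dbl n + dbl Q)) → b n ≡ b (n + Q)
  μ-halve-odd {n} {Q} e = not-injective (begin
    not (b n)               ≡⟨ sym (μ-odd-letter n) ⟩
    w (suc (dbl n))         ≡⟨ e ⟩
    w (suc (dbl n + dbl Q)) ≡⟨ cong (λ k → w (suc k)) (sym (dbl-+ n Q)) ⟩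
    w (suc (dbl (n + Q)))   ≡⟨ μ-odd-letter (n + Q) ⟩
    not (b (n + Q))         ∎)

  μ-halve-period₀ : ∀ {Q} → OverlapPrefix w (dbl Q) → OverlapPrefix b Q
  μ-halve-period₀ H n n≤Q = μ-halve-even (H (dbl n) (dbl-mono-≤ n≤Q))

  μ-halve-period₁ : ∀ {Q} → OverlapPrefix (shift 1 w) (dbl Q) → OverlapPrefix b Q
  μ-halve-period₁ H n n≤Q = μ-halve-odd (H (dbl n) (dbl-mono-≤ n≤Q))

  oddPeriod-even : ∀ {n r} → w (dbl n) ≡ w (dbl n + suc (dbl r)) → b n ≡ not (b (n + r))
  oddPeriod-even {n} {r} e = begin
    b n                        ≡⟨ sym (μ-even-letter n) ⟩
    w (dbl n)                  ≡⟨ e ⟩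
    w (dbl n + suc (dbl r))    ≡⟨ cong w (dbl-+-odd n r) ⟩
    w (suc (dbl (n + r)))      ≡⟨ μ-odd-letter (n + r) ⟩
    not (b (n + r))            ∎

  oddPeriod-odd : ∀ {n r} → w (suc (dbl n)) ≡ w (suc (dbl n) + suc (dbl r)) →
    not (b n) ≡ b (suc (n + r))
  oddPeriod-odd {n} {r} e = begin
    not (b n)                     ≡⟨ sym (μ-odd-letter n) ⟩
    w (suc (dbl n))               ≡⟨ e ⟩
    w (suc (dbl n + suc (dbl r))) ≡⟨ cong (λ k → w (suc k)) (dbl-+-odd n r) ⟩
    w (dbl (suc (n + r)))         ≡⟨ μ-even-letter (suc (n + r)) ⟩
    b (suc (n + r))               ∎

  oddPeriod-pair-even : ∀ {n r} → w (dbl n) ≡ w (dbl n + suc (dbl r)) →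
    w (suc (dbl n)) ≡ w (suc (dbl n) + suc (dbl r)) → b (n + r) ≡ b (suc (n + r))
  oddPeriod-pair-even {n} {r} e₀ e₁ =
    trans (sym (not-involutive _)) (trans (cong not (sym (oddPeriod-even e₀))) (oddPeriod-odd e₁))

  oddPeriod-pair-odd : ∀ {n r} → w (suc (dbl n)) ≡ w (suc (dbl n) + suc (dbl r)) →
    w (dbl (suc n)) ≡ w (dbl (suc n) + suc (dbl r)) → b n ≡ b (suc n)
  oddPeriod-pair-odd {n} {r} e₀ e₁ =
    trans (sym (not-involutive _)) (trans (cong not (oddPeriod-odd e₀)) (sym (oddPeriod-even e₁)))

  oddPeriod-cube₀ : ∀ {r} → (∀ j → j ≤ 3 → w j ≡ w (j + suc (dbl (suc r)))) →
    OverlapPrefix (shift (suc r) b) 1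
  oddPeriod-cube₀ {r} H = cube {b} (suc r)
    (oddPeriod-pair-even {0} {suc r} (H 0 z≤n) (H 1 (s≤s z≤n)))
    (oddPeriod-pair-even {1} {suc r} (H 2 (s≤s (s≤s z≤n))) (H 3 (s≤s (s≤s (s≤s z≤n)))))

  oddPeriod-cube₁ : ∀ {r} → (∀ j → j ≤ 3 → w (suc j) ≡ w (suc j + suc (dbl (suc r)))) →
    OverlapPrefix b 1
  oddPeriod-cube₁ {r} H = cube {b} 0
    (oddPeriod-pair-odd {0} {suc r} (H 0 z≤n) (H 1 (s≤s z≤n)))
    (oddPeriod-pair-odd {1} {suc r} (H 2 (s≤s (s≤s z≤n))) (H 3 (s≤s (s≤s (s≤s z≤n)))))

  μ-desubstitute₀ : ∀ {p} → OverlapPrefix w (suc p) → ShorterOverlap b p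
  μ-desubstitute₀ {p} H with parity p
  ... | even zero    = ⊥-elim (μ-adjacent-distinct 0 (H 0 z≤n))
  ... | even (suc r) = suc r , 0 , s≤s z≤n ,
                       oddPeriod-cube₀ (λ j j≤3 → H j (≤-trans j≤3 (s≤s (s≤s (s≤s z≤n)))))
  ... | odd q        = 0 , q , s≤s (n≤dbl q) , μ-halve-period₀ H

  μ-desubstitute₁ : ∀ {p} → OverlapPrefix (shift 1 w) (suc p) → ShorterOverlap b p
  μ-desubstitute₁ {p} H with parity p
  ... | even zero    = ⊥-elim (μ-adjacent-distinct 1 (H 1 (s≤s z≤n)))
  ... | even (suc r) = 0 , 0 , s≤s z≤n ,
                       oddPeriod-cube₁ (λ j j≤3 → H j (≤-trans j≤3 (s≤s (s≤s (s≤s z≤n)))))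
  ... | odd q        = 0 , q , s≤s (n≤dbl q) , μ-halve-period₁ H

-- Shifting by an even amount keeps w a μ-image, reducing an overlap at i to one at i mod 2.
μ-desubstitute : ∀ {w b} → IsμImage w b → ∀ i {p} → OverlapPrefix (shift i w) (suc p) → ShorterOverlap b p
μ-desubstitute {w} {b} m i H with parity i
... | even k = shorterOverlap-shift {b} k (μ-desubstitute₀ (shift-isμImage k m) H)
... | odd k  = shorterOverlap-shift {b} k (μ-desubstitute₁ (shift-isμImage k m)
                 (overlapPrefix-resp-≗ (λ n → cong w (sym (+-suc (dbl k) n))) H))

μ-overlapFree′ : ∀ {w b} → IsμImage w b → OverlapFree′ b → OverlapFree′ w
μ-overlapFree′ m ofb i p H with μ-desubstitute m i H
... | k , p′ , _ , H′ = ofb k p′ H′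

μ-tails-overlapFree′ : {I : Set} (F : I → InfWord) →
  (∀ x → ∃[ y ] ∃[ v ] (IsμImage v (F y) × F x ≡ shift 1 v)) → ∀ x → OverlapFree′ (F x)
μ-tails-overlapFree′ F tail x i p = <-rec (λ p → ∀ x i → ¬ OverlapPrefix (shift i (F x)) (suc p)) step p x i
  where
  step : ∀ p → (∀ {p′} → p′ < p → ∀ x i → ¬ OverlapPrefix (shift i (F x)) (suc p′)) →
         ∀ x i → ¬ OverlapPrefix (shift i (F x)) (suc p)
  step p shorter x i H with tail x
  ... | y , v , m , Fx≡ with μ-desubstitute m (suc i) (subst (λ u → OverlapPrefix (shift i u) (suc p)) Fx≡ H)
  ... | k , p′ , p′<p , H′ = shorter p′<p y k H′

-- Periods 1 and 3 are excluded by explicit letters and odd periods ≥ 5 give a cube in b; an even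
-- period would make the equal letters v 0, v 1 reappear at the complementary positions 2q, 2q + 1
-- of the μ-image.
noOverlapPrefix-11μ : ∀ {v b} → v 0 ≡ true → v 1 ≡ true → IsμImage (shift 2 v) b →
  b 0 ≡ false → b 2 ≡ false → OverlapFree′ b → ∀ p → ¬ OverlapPrefix v (suc p)
noOverlapPrefix-11μ {v} {b} v₀ v₁ m b₀ b₂ ofb p H with parity p
... | even zero = not-¬ refl (begin
  true       ≡⟨ sym v₁ ⟩
  v 1        ≡⟨ H 1 (s≤s z≤n) ⟩
  v 2        ≡⟨ μ-even-letter m 0 ⟩
  b 0        ≡⟨ b₀ ⟩
  false      ∎)
... | even (suc zero) = not-¬ refl (begin
  true       ≡⟨ cong not (sym b₀) ⟩
  not (b 0)  ≡⟨ sym (μ-odd-letter m 0) ⟩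
  v 3        ≡⟨ H 3 (s≤s (s≤s (s≤s z≤n))) ⟩
  v 6        ≡⟨ μ-even-letter m 2 ⟩
  b 2        ≡⟨ b₂ ⟩
  false      ∎)
... | even (suc (suc r)) = ofb (suc (suc r)) 0
      (oddPeriod-cube₀ m (λ j j≤3 → H (2 + j) (s≤s (s≤s (≤-trans j≤3 (s≤s (s≤s (s≤s z≤n))))))))
... | odd q = not-¬ (sym bq≡true) (sym (begin
  not (b q)         ≡⟨ sym (μ-odd-letter m q) ⟩
  v (3 + dbl q)     ≡⟨ sym (H 1 (s≤s z≤n)) ⟩
  v 1               ≡⟨ v₁ ⟩
  true              ∎))
  where
  bq≡true : b q ≡ true
  bq≡true = begin
    b q             ≡⟨ sym (μ-even-letter m q) ⟩
    v (2 + dbl q)   ≡⟨ sym (H 0 z≤n) ⟩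
    v 0             ≡⟨ v₀ ⟩
    true            ∎

thueMorse-μ-prepend : ∀ u → IsμImage (μ u · thueMorse) (u · thueMorse)
thueMorse-μ-prepend u = μ-prepend u thueMorse-isμImage

letter-thueMorse-overlapFree′ : ∀ x → OverlapFree′ ((x ∷ []) · thueMorse)
letter-thueMorse-overlapFree′ = μ-tails-overlapFree′ (λ x → (x ∷ []) · thueMorse)
  (λ x → not x , μ (not x ∷ []) · thueMorse , thueMorse-μ-prepend (not x ∷ []) , tail x)
  where
  tail : ∀ x → (x ∷ []) · thueMorse ≡ shift 1 (μ (not x ∷ []) · thueMorse)
  tail false = refl
  tail true  = refl

u₁-thueMorse-overlapFree′ : OverlapFree′ (u₁ · thueMorse)
u₁-thueMorse-overlapFree′ =
  μ-overlapFree′ (thueMorse-μ-prepend (false ∷ false ∷ true ∷ []))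
    (overlapFree′-tail {μ (true ∷ false ∷ []) · thueMorse}
      (μ-overlapFree′ (thueMorse-μ-prepend (true ∷ false ∷ []))
        (μ-overlapFree′ (thueMorse-μ-prepend (true ∷ [])) (letter-thueMorse-overlapFree′ true))))

110110-thueMorse-overlapFree′ : OverlapFree′ ((true ∷ true ∷ false ∷ true ∷ true ∷ false ∷ []) · thueMorse)
110110-thueMorse-overlapFree′ = overlapFree′-∷ {w}
  (noOverlapPrefix-11μ {w} refl refl (thueMorse-μ-prepend (false ∷ true ∷ [])) refl refl
    (μ-overlapFree′ (thueMorse-μ-prepend (false ∷ [])) (letter-thueMorse-overlapFree′ false)))
  (overlapFree′-tail {u₁ · thueMorse} u₁-thueMorse-overlapFree′)
  where
  w : InfWord
  w = (true ∷ true ∷ false ∷ true ∷ true ∷ false ∷ []) · thueMorse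

lemma1 : OverlapFree (u₁ · thueMorse) × OverlapFree (u₂ · thueMorse)
lemma1 =
    overlapFree′⇒overlapFree u₁-thueMorse-overlapFree′
  , overlapFree′⇒overlapFree
      (μ-overlapFree′ (thueMorse-μ-prepend (true ∷ true ∷ false ∷ true ∷ true ∷ false ∷ []))
        110110-thueMorse-overlapFree′)
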